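{- $\mathscr{G}(1,1)=\{S_{1,1}\}$ and $\mathscr{G}(1,2)=\{S_{2,2}\}$ (up to isomorphism).
   Context: Graphs are finite, simple and undirected; eigenvalues are those of the adjacency matrix. An eigenvalue of $G$ is main if it has an eigenvector with nonzero entry sum. For integers $a,b$, $\mathscr{G}(a,b)$ is the set of connected graphs with exactly two main eigenvalues satisfying $\sum_{u\in N(v)}d(u)=a\,d(v)+b$ for every vertex $v$. For $n_1,n_2\ge 1$, the double star $S_{n_1,n_2}$ is the tree obtained from an edge $uv$ by attaching $n_1$ pendant vertices to $u$ and $n_2$ pendant vertices to $v$. -}

module Defs where

open import Data.Nat using (ℕ; zero; suc; _≡ᵇ_; _<ᵇ_) renaming (_+_ to _+ℕ_)
open import Data.Integer using (ℤ; +_) renaming (_+_ to _+ℤ_; _*_ to _*ℤ_)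
open import Data.Bool using (Bool; true; false; if_then_else_; _∧_; _∨_; not)
open import Data.Fin using (Fin; toℕ) renaming (zero to fzero; suc to fsuc)
open import Data.List using (List; []; _∷_; _++_; length)
open import Data.Product using (Σ; ∃; _×_; _,_)
open import Data.Sum using (_⊎_)
open import Relation.Binary.PropositionalEquality using (_≡_; _≢_)
open import Relation.Nullary using (¬_)
open import Function.Bundles using (_↔_; Inverse)

-- Real closed fields (standing in for ℝ; the statement quantifies over
-- all of them, ℝ being one).

horner : {A : Set} → A → (A → A → A) → (A → A → A) → List A → A → A
horner z _+_ _*_ []       x = z
horner z _+_ _*_ (c ∷ cs) x = c + (x * horner z _+_ _*_ cs x)

record RealClosedField : Set₁ where
  infixl 6 _+_
  infixl 7 _*_
  infix  4 _≤_
  field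
    Carrier : Set
    0# 1#   : Carrier
    _+_ _*_ : Carrier → Carrier → Carrier
    -_      : Carrier → Carrier
    _≤_     : Carrier → Carrier → Set
    +-assoc    : ∀ x y z → (x + y) + z ≡ x + (y + z)
    +-comm     : ∀ x y → x + y ≡ y + x
    +-identity : ∀ x → 0# + x ≡ x
    +-inverse  : ∀ x → x + (- x) ≡ 0#
    *-assoc    : ∀ x y z → (x * y) * z ≡ x * (y * z)
    *-comm     : ∀ x y → x * y ≡ y * x
    *-identity : ∀ x → 1# * x ≡ x
    distrib    : ∀ x y z → x * (y + z) ≡ (x * y) + (x * z)
    0≢1        : 0# ≢ 1#
    inverse    : ∀ x → x ≢ 0# → Σ Carrier (λ y → x * y ≡ 1#)
    ≤-refl     : ∀ x → x ≤ x
    ≤-trans    : ∀ {x y z} → x ≤ y → y ≤ z → x ≤ z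
    ≤-antisym  : ∀ {x y} → x ≤ y → y ≤ x → x ≡ y
    ≤-total    : ∀ x y → x ≤ y ⊎ y ≤ x
    +-mono-≤   : ∀ {x y} z → x ≤ y → x + z ≤ y + z
    *-nonneg   : ∀ {x y} → 0# ≤ x → 0# ≤ y → 0# ≤ x * y
    sqrt       : ∀ x → 0# ≤ x → Σ Carrier (λ y → y * y ≡ x)
    -- Horner evaluation of the monic polynomial X^(length cs) + Σ cs_i X^i
    odd-root   : ∀ (k : ℕ) (cs : List Carrier) → length cs ≡ suc (k +ℕ k) →
                 Σ Carrier (λ x → horner 0# _+_ _*_ (cs ++ (1# ∷ [])) x ≡ 0#)

Adj : ℕ → Set
Adj n = Fin n → Fin n → Bool

IsSimpleGraph : ∀ {n} → Adj n → Set
IsSimpleGraph {n} A = (∀ u v → A u v ≡ A v u) × (∀ v → A v v ≡ false)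

sumℕ : ∀ n → (Fin n → ℕ) → ℕ
sumℕ zero    f = 0
sumℕ (suc n) f = f fzero +ℕ sumℕ n (λ i → f (fsuc i))

degree : ∀ {n} → Adj n → Fin n → ℕ
degree {n} A v = sumℕ n (λ u → if A v u then 1 else 0)

neighbourDegreeSum : ∀ {n} → Adj n → Fin n → ℕ
neighbourDegreeSum {n} A v = sumℕ n (λ u → if A v u then degree A u else 0)

data Walk {n} (A : Adj n) : Fin n → Fin n → Set where
  here : ∀ {v} → Walk A v v
  step : ∀ {u w v} → A u w ≡ true → Walk A w v → Walk A u v

Connected : ∀ {n} → Adj n → Set
Connected {n} A = ∀ (u v : Fin n) → Walk A u v

_≅_ : ∀ {n m} → Adj n → Adj m → Set
_≅_ {n} {m} A B =
  Σ (Fin n ↔ Fin m) (λ f → ∀ u v → A u v ≡ B (Inverse.to f u) (Inverse.to f v))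

module _ (F : RealClosedField) where
  open RealClosedField F

  sumF : ∀ n → (Fin n → Carrier) → Carrier
  sumF zero    f = 0#
  sumF (suc n) f = f fzero + sumF n (λ i → f (fsuc i))

  adjMatrix : ∀ {n} → Adj n → Fin n → Fin n → Carrier
  adjMatrix A u v = if A u v then 1# else 0#

  IsMainEigenvalue : ∀ {n} → Adj n → Carrier → Set
  IsMainEigenvalue {n} A λ′ =
    Σ (Fin n → Carrier) (λ x →
      (∀ i → sumF n (λ j → adjMatrix A i j * x j) ≡ λ′ * x i)
      × ¬ (sumF n x ≡ 0#))

  HasExactlyTwoMainEigenvalues : ∀ {n} → Adj n → Set
  HasExactlyTwoMainEigenvalues A =
    Σ Carrier (λ λ₁ → Σ Carrier (λ λ₂ →
      λ₁ ≢ λ₂ × IsMainEigenvalue A λ₁ × IsMainEigenvalue A λ₂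
      × (∀ μ → IsMainEigenvalue A μ → μ ≡ λ₁ ⊎ μ ≡ λ₂)))

  InClass : ℤ → ℤ → ∀ {n} → Adj n → Set
  InClass a b A =
    Connected A × HasExactlyTwoMainEigenvalues A
    × (∀ v → + neighbourDegreeSum A v ≡ a *ℤ (+ degree A v) +ℤ b)

-- Double star S_{n₁,n₂} on Fin (2 + n₁ + n₂): vertex 0 = u, vertex 1 = v,
-- vertices 2 .. 1+n₁ are pendant at u, vertices 2+n₁ .. 1+n₁+n₂ at v.

private
  dsEdge : ℕ → ℕ → ℕ → Bool
  dsEdge n₁ a b =
      ((a ≡ᵇ 0) ∧ (b ≡ᵇ 1))
    ∨ ((a ≡ᵇ 0) ∧ ((1 <ᵇ b) ∧ (b <ᵇ (2 +ℕ n₁))))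
    ∨ ((a ≡ᵇ 1) ∧ not (b <ᵇ (2 +ℕ n₁)))

doubleStar : ∀ n₁ n₂ → Adj (2 +ℕ n₁ +ℕ n₂)
doubleStar n₁ n₂ i j = dsEdge n₁ (toℕ i) (toℕ j) ∨ dsEdge n₁ (toℕ j) (toℕ i)

-- With a = 1 the degree condition says that Σ_{u ∼ v} (d u - 1) = b at every vertex v.
-- Hence the neighbour of a leaf has degree b + 1; a vertex adjacent to one of degree b + 1
-- has only leaves as further neighbours, so unless it is a leaf it has degree b + 1 itself;
-- and a vertex of degree > b has a leaf neighbour. As soon as G has a leaf, G therefore
-- consists of two adjacent centres of degree b + 1 carrying b leaves each: G ≅ S_{b,b}.
-- A leaf exists for b = 1, since every vertex has a neighbour of degree 2, and for b = 2
-- unless G is 2-regular, which is excluded as a regular graph has one main eigenvalue.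
-- Conversely, A² 1 = a A 1 + b 1 for the all-ones vector 1, so every main eigenvalue is a
-- root of X² - a X - b; for each root r, with r′ the other one, d - r′ 1 is an eigenvector
-- for r whose entry sum vanishes only if the average degree is a root as well, which it is
-- not for S_{1,1} and S_{2,2}.

module Submission where

open import Defs
open import Algebra.Bundles using (CommutativeRing)
open import Algebra.Solver.Ring.AlmostCommutativeRing using (fromCommutativeRing; _-Raw-AlmostCommutative⟶_)
import Algebra.Properties.AbelianGroup as AbelianGroupProperties
import Algebra.Properties.CommutativeSemigroup as CommutativeSemigroupProperties
import Algebra.Properties.Ring as RingProperties
import Algebra.Properties.Semiring.Mult.TCOptimised as SemiringMult
import Algebra.Solver.Ring as RingSolver
open import Data.Bool using (Bool; true; false; if_then_else_; _∧_; _∨_; not)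
open import Data.Bool.Properties using (∧-identityʳ; ∨-comm)
import Data.Bool.Properties as Bool
open import Data.Empty using (⊥-elim)
open import Data.Fin using (Fin; zero; suc; toℕ; _↑ˡ_; _↑ʳ_; splitAt)
open import Data.Fin.Patterns using (0F; 1F; 2F; 3F; 4F; 5F)
open import Data.Fin.Permutation using (↔⇒≡)
open import Data.Fin.Properties
  using (any?; ¬∀⟶∃¬; suc-injective; _≟_; toℕ-↑ˡ; toℕ-↑ʳ; toℕ<n; splitAt⁻¹-↑ˡ; splitAt⁻¹-↑ʳ; splitAt-↑ˡ; splitAt-↑ʳ)
open import Data.Integer using (ℤ; +_; -[1+_])
import Data.Integer as ℤ
import Data.Integer.Properties as ℤ
open import Data.Maybe using (Maybe; just; nothing)
open import Data.Nat using (ℕ; zero; suc)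
import Data.Nat as ℕ
import Data.Nat.Properties as ℕ
open import Data.Product using (∃; _,_; proj₁; proj₂)
open import Data.Sign as Sign using (Sign)
open import Data.Sum using (_⊎_; inj₁; inj₂; [_,_]′)
open import Function using (_∘_; case_of_)
open import Function.Bundles using (_↔_; _⇔_; Inverse; mk↔ₛ′; mk⇔)
open import Function.Definitions using (Injective)
open import Relation.Binary.PropositionalEquality
open import Relation.Nullary using (¬_; yes; no; does)
open import Relation.Nullary.Decidable using (_×-dec_)

-- Arithmetic in a real closed field

module Arithmetic (F : RealClosedField) where
  open RealClosedField F

  commutativeRing : CommutativeRing _ _
  commutativeRing = record
    { Carrier = Carrier ; _≈_ = _≡_ ; _+_ = _+_ ; _*_ = _*_ ; -_ = -_ ; 0# = 0# ; 1# = 1#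
    ; isCommutativeRing = record
      { isRing = record
        { +-isAbelianGroup = record
          { isGroup = record
            { isMonoid = record
              { isSemigroup = record
                { isMagma = record { isEquivalence = isEquivalence ; ∙-cong = cong₂ _+_ }
                ; assoc = +-assoc }
              ; identity = +-identity , λ x → trans (+-comm x 0#) (+-identity x) }
            ; inverse = (λ x → trans (+-comm (- x) x) (+-inverse x)) , +-inverse
            ; ⁻¹-cong = cong -_ }
          ; comm = +-comm }
        ; *-cong = cong₂ _*_
        ; *-assoc = *-assoc
        ; *-identity = *-identity , λ x → trans (*-comm x 1#) (*-identity x)
        ; distrib = distrib , λ x y z → trans (*-comm (y + z) x)
                                         (trans (distrib x y z) (cong₂ _+_ (*-comm x y) (*-comm x z))) }
      ; *-comm = *-comm } }

  open CommutativeRing commutativeRing public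
    using (_-_; +-identityʳ; *-identityʳ; zeroˡ; zeroʳ; distribʳ; +-abelianGroup; ring; semiring; *-commutativeSemigroup)
  open AbelianGroupProperties +-abelianGroup public
    using (ε⁻¹≈ε; ⁻¹-involutive; ⁻¹-∙-comm; x∙y⁻¹≈ε⇒x≈y; x≈y⇒x∙y⁻¹≈ε)
  open SemiringMult semiring public using (_×_; 1+×; ×-homo-+; ×1-homo-*)
  open CommutativeSemigroupProperties *-commutativeSemigroup using (interchange)

  ⟦_⟧ : ℤ → Carrier
  ⟦ + n ⟧    = n × 1#
  ⟦ -[1+ n ] ⟧ = - (suc n × 1#)

  private
    sign : Sign → Carrier
    sign Sign.+ = 1#
    sign Sign.- = - 1#

    sign-homo : ∀ s t → sign (s Sign.* t) ≡ sign s * sign t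
    sign-homo Sign.- Sign.- = sym (trans (RingProperties.-1*x≈-x ring (- 1#)) (⁻¹-involutive 1#))
    sign-homo Sign.- Sign.+ = sym (trans (*-comm (- 1#) 1#) (*-identity (- 1#)))
    sign-homo Sign.+ t      = sym (*-identity (sign t))

    ◃-homo : ∀ s n → ⟦ s ℤ.◃ n ⟧ ≡ sign s * (n × 1#)
    ◃-homo s      zero    = sym (zeroʳ (sign s))
    ◃-homo Sign.+ (suc n) = sym (*-identity _)
    ◃-homo Sign.- (suc n) = sym (RingProperties.-1*x≈-x ring _)

    ⟦⟧-sign-abs : ∀ i → ⟦ i ⟧ ≡ sign (ℤ.sign i) * (ℤ.∣ i ∣ × 1#)
    ⟦⟧-sign-abs i = trans (cong ⟦_⟧ (sym (ℤ.◃-inverse i))) (◃-homo (ℤ.sign i) ℤ.∣ i ∣)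

    ⊖-homo : ∀ m n → ⟦ m ℤ.⊖ n ⟧ ≡ m × 1# - n × 1#
    ⊖-homo m       zero    = sym (trans (cong (_+_ (m × 1#)) ε⁻¹≈ε) (+-identityʳ _))
    ⊖-homo zero    (suc n) = sym (+-identity _)
    ⊖-homo (suc m) (suc n) = begin
      ⟦ suc m ℤ.⊖ suc n ⟧               ≡⟨ cong ⟦_⟧ (ℤ.[1+m]⊖[1+n]≡m⊖n m n) ⟩
      ⟦ m ℤ.⊖ n ⟧                       ≡⟨ ⊖-homo m n ⟩
      m × 1# + - (n × 1#)               ≡⟨ cong (_+_ (m × 1#)) (sym (+-identity _)) ⟩
      m × 1# + (0# + - (n × 1#))        ≡⟨ cong (λ z → m × 1# + (z + - (n × 1#))) (sym (+-inverse 1#)) ⟩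
      m × 1# + ((1# + - 1#) + - (n × 1#)) ≡⟨ cong (_+_ (m × 1#)) (+-assoc 1# (- 1#) _) ⟩
      m × 1# + (1# + (- 1# + - (n × 1#))) ≡⟨ sym (+-assoc _ 1# _) ⟩
      (m × 1# + 1#) + (- 1# + - (n × 1#)) ≡⟨ cong₂ _+_ (+-comm _ 1#) (⁻¹-∙-comm 1# _) ⟩
      (1# + m × 1#) - (1# + n × 1#)     ≡⟨ sym (cong₂ _-_ (1+× m 1#) (1+× n 1#)) ⟩
      suc m × 1# - suc n × 1#           ∎
      where open ≡-Reasoning

  +-homo : ∀ i j → ⟦ i ℤ.+ j ⟧ ≡ ⟦ i ⟧ + ⟦ j ⟧
  +-homo (+ m)    (+ n)    = ×-homo-+ 1# m n
  +-homo (+ m)    -[1+ n ] = ⊖-homo m (suc n)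
  +-homo -[1+ m ] (+ n)    = trans (⊖-homo n (suc m)) (+-comm _ _)
  +-homo -[1+ m ] -[1+ n ] = begin
    - (suc (suc (m ℕ.+ n)) × 1#)           ≡⟨ cong (λ k → - (k × 1#)) (sym (ℕ.+-suc (suc m) n)) ⟩
    - ((suc m ℕ.+ suc n) × 1#)             ≡⟨ cong -_ (×-homo-+ 1# (suc m) (suc n)) ⟩
    - (suc m × 1# + suc n × 1#)            ≡⟨ sym (⁻¹-∙-comm _ _) ⟩
    - (suc m × 1#) + - (suc n × 1#)        ∎
    where open ≡-Reasoning

  *-homo : ∀ i j → ⟦ i ℤ.* j ⟧ ≡ ⟦ i ⟧ * ⟦ j ⟧
  *-homo i j = begin
    ⟦ i ℤ.* j ⟧                                     ≡⟨ ◃-homo (s Sign.* t) (∣i∣ ℕ.* ∣j∣) ⟩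
    sign (s Sign.* t) * ((∣i∣ ℕ.* ∣j∣) × 1#)       ≡⟨ cong₂ _*_ (sign-homo s t) (×1-homo-* ∣i∣ ∣j∣) ⟩
    (sign s * sign t) * (∣i∣ × 1# * ∣j∣ × 1#)       ≡⟨ interchange _ _ _ _ ⟩
    (sign s * ∣i∣ × 1#) * (sign t * ∣j∣ × 1#)       ≡⟨ sym (cong₂ _*_ (⟦⟧-sign-abs i) (⟦⟧-sign-abs j)) ⟩
    ⟦ i ⟧ * ⟦ j ⟧                                   ∎
    where
    open ≡-Reasoning
    s = ℤ.sign i
    t = ℤ.sign j
    ∣i∣ = ℤ.∣ i ∣
    ∣j∣ = ℤ.∣ j ∣

  -‿homo : ∀ i → ⟦ ℤ.- i ⟧ ≡ - ⟦ i ⟧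
  -‿homo -[1+ n ]    = sym (⁻¹-involutive _)
  -‿homo (+ zero)    = sym ε⁻¹≈ε
  -‿homo (+ suc n)   = refl

  private
    ℤ-morphism : CommutativeRing.rawRing ℤ.+-*-commutativeRing -Raw-AlmostCommutative⟶ fromCommutativeRing commutativeRing
    ℤ-morphism = record
      { ⟦_⟧ = ⟦_⟧ ; +-homo = +-homo ; *-homo = *-homo ; -‿homo = -‿homo ; 0-homo = refl ; 1-homo = refl }

    ⟦⟧-equal? : ∀ i j → Maybe (⟦ i ⟧ ≡ ⟦ j ⟧)
    ⟦⟧-equal? i j with i ℤ.≟ j
    ... | yes refl = just refl
    ... | no _     = nothing

  open RingSolver _ (fromCommutativeRing commutativeRing) ℤ-morphism ⟦⟧-equal? public
    using (solve; _:=_; con; _:+_; _:*_; :-_; _:-_)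

  *-cancelˡ-0 : ∀ {x y} → x ≢ 0# → x * y ≡ 0# → y ≡ 0#
  *-cancelˡ-0 {x} {y} x≢0 xy≡0 with inverse x x≢0
  ... | x⁻¹ , xx⁻¹≡1 = begin
    y              ≡⟨ sym (*-identity y) ⟩
    1# * y         ≡⟨ cong (_* y) (sym xx⁻¹≡1) ⟩
    (x * x⁻¹) * y  ≡⟨ solve 3 (λ x x⁻¹ y → (x :* x⁻¹) :* y := x⁻¹ :* (x :* y)) refl x x⁻¹ y ⟩
    x⁻¹ * (x * y)  ≡⟨ cong (x⁻¹ *_) xy≡0 ⟩
    x⁻¹ * 0#       ≡⟨ zeroʳ x⁻¹ ⟩
    0#             ∎
    where open ≡-Reasoning

  *-cancelʳ-≢0 : ∀ {x y z} → z ≢ 0# → x * z ≡ y * z → x ≡ y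
  *-cancelʳ-≢0 {x} {y} {z} z≢0 xz≡yz = x∙y⁻¹≈ε⇒x≈y x y (*-cancelˡ-0 z≢0 (begin
    z * (x - y)        ≡⟨ solve 3 (λ x y z → z :* (x :- y) := x :* z :- y :* z) refl x y z ⟩
    x * z - y * z      ≡⟨ x≈y⇒x∙y⁻¹≈ε xz≡yz ⟩
    0#                 ∎))
    where open ≡-Reasoning

  0≤1 : 0# ≤ 1#
  0≤1 with ≤-total 0# 1#
  ... | inj₁ 0≤1 = 0≤1
  ... | inj₂ 1≤0 = subst (0# ≤_) (solve 0 (:- con (+ 1) :* :- con (+ 1) := con (+ 1)) refl)
                         (*-nonneg 0≤-1 0≤-1)
    where
    0≤-1 : 0# ≤ - 1#
    0≤-1 = subst₂ _≤_ (+-inverse 1#) (+-identity (- 1#)) (+-mono-≤ (- 1#) 1≤0)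

  ≤-cancelʳ : ∀ {x y} z → x + z ≤ y + z → x ≤ y
  ≤-cancelʳ {x} {y} z x+z≤y+z = subst₂ _≤_ (cancel x) (cancel y) (+-mono-≤ (- z) x+z≤y+z)
    where
    cancel : ∀ w → w + z + - z ≡ w
    cancel w = solve 2 (λ w z → w :+ z :- z := w) refl w z

  0≤×1# : ∀ n → 0# ≤ n × 1#
  0≤×1# zero    = ≤-refl 0#
  0≤×1# (suc n) = ≤-trans 0≤1 (subst₂ _≤_ (+-identityʳ 1#) (sym (1+× n 1#)) (+-mono-≤′ (0≤×1# n)))
    where
    +-mono-≤′ : ∀ {a b} → a ≤ b → 1# + a ≤ 1# + b
    +-mono-≤′ {a} {b} a≤b = subst₂ _≤_ (+-comm a 1#) (+-comm b 1#) (+-mono-≤ 1# a≤b)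

  1+n×1#≢0 : ∀ n → suc n × 1# ≢ 0#
  1+n×1#≢0 n eq = 0≢1 (≤-antisym 0≤1 (subst (1# ≤_) eq 1≤1+n×1#))
    where
    1≤1+n×1# : 1# ≤ suc n × 1#
    1≤1+n×1# = subst₂ _≤_ (+-identity 1#) (trans (+-comm (n × 1#) 1#) (sym (1+× n 1#)))
                       (+-mono-≤ 1# (0≤×1# n))

  ×1#-injective : ∀ m n → m × 1# ≡ n × 1# → m ≡ n
  ×1#-injective zero    zero    eq = refl
  ×1#-injective zero    (suc n) eq = ⊥-elim (1+n×1#≢0 n (sym eq))
  ×1#-injective (suc m) zero    eq = ⊥-elim (1+n×1#≢0 m eq)
  ×1#-injective (suc m) (suc n) eq =
    cong suc (×1#-injective m n (cancel (trans (sym (1+× m 1#)) (trans eq (1+× n 1#)))))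
    where
    cancel : ∀ {a b} → 1# + a ≡ 1# + b → a ≡ b
    cancel {a} {b} e = begin
      a                ≡⟨ solve 1 (λ a → a := :- con (+ 1) :+ (con (+ 1) :+ a)) refl a ⟩
      - 1# + (1# + a)  ≡⟨ cong (_+_ (- 1#)) e ⟩
      - 1# + (1# + b)  ≡⟨ solve 1 (λ b → :- con (+ 1) :+ (con (+ 1) :+ b) := b) refl b ⟩
      b                ∎
      where open ≡-Reasoning

  private
    ordered-roots : ∀ {α β μ} → α ≤ β → α ≢ β → (μ - α) * (μ - β) ≡ 0# → μ ≡ α ⊎ μ ≡ β
    ordered-roots {α} {β} {μ} α≤β α≢β eq with ≤-total (μ + μ) (α + β)
    ... | inj₁ 2μ≤α+β = inj₁ (x∙y⁻¹≈ε⇒x≈y μ α (*-cancelˡ-0 μ-β≢0 (trans (*-comm _ _) eq)))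
      where
      μ-β≢0 : μ - β ≢ 0#
      μ-β≢0 μ-β≡0 = α≢β (≤-antisym α≤β (≤-cancelʳ β
        (subst (λ m → m + m ≤ α + β) (x∙y⁻¹≈ε⇒x≈y μ β μ-β≡0) 2μ≤α+β)))
    ... | inj₂ α+β≤2μ = inj₂ (x∙y⁻¹≈ε⇒x≈y μ β (*-cancelˡ-0 μ-α≢0 eq))
      where
      μ-α≢0 : μ - α ≢ 0#
      μ-α≢0 μ-α≡0 = α≢β (≤-antisym α≤β (≤-cancelʳ α (subst₂ _≤_ (+-comm α β) refl
        (subst (λ m → α + β ≤ m + m) (x∙y⁻¹≈ε⇒x≈y μ α μ-α≡0) α+β≤2μ))))

  -- Equality in F is undecidable; which factor of (μ - α) (μ - β) vanishes is found
  -- by comparing μ with the midpoint of α and β.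
  product-roots : ∀ {α β μ} → α ≢ β → (μ - α) * (μ - β) ≡ 0# → μ ≡ α ⊎ μ ≡ β
  product-roots {α} {β} α≢β eq with ≤-total α β
  ... | inj₁ α≤β = ordered-roots α≤β α≢β eq
  ... | inj₂ β≤α with ordered-roots β≤α (α≢β ∘ sym) (trans (*-comm _ _) eq)
  ...   | inj₁ μ≡β = inj₂ μ≡β
  ...   | inj₂ μ≡α = inj₁ μ≡α

-- Main eigenvalues

DegreeCondition : ℤ → ℤ → ∀ {n} → Adj n → Set
DegreeCondition a b G = ∀ v → + neighbourDegreeSum G v ≡ a ℤ.* + degree G v ℤ.+ b

-- for D the degree sum of a graph on n vertices: the average degree D / n is not a root of X² - a X - b
AverageIsNotRoot : ℕ → ℕ → ℕ → ℕ → Set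
AverageIsNotRoot a b n D = D ℕ.* D ≢ a ℕ.* n ℕ.* D ℕ.+ b ℕ.* (n ℕ.* n)

module Spectrum (F : RealClosedField) where
  open RealClosedField F
  open Arithmetic F
  open import Algebra.Properties.Semiring.Sum semiring using (sum; sum-cong-≗; ∑-distrib-+; ∑-comm; *-distribˡ-sum; *-distribʳ-sum)

  sumF≡sum : ∀ n (f : Fin n → Carrier) → sumF F n f ≡ sum f
  sumF≡sum zero    f = refl
  sumF≡sum (suc n) f = cong (_+_ (f zero)) (sumF≡sum n (λ i → f (suc i)))

  ⟦+⟧-sum : ∀ n (f : Fin n → ℕ) → ⟦ + sumℕ n f ⟧ ≡ sum (λ i → ⟦ + f i ⟧)
  ⟦+⟧-sum zero    f = refl
  ⟦+⟧-sum (suc n) f = trans (×-homo-+ 1# (f zero) _) (cong (_+_ _) (⟦+⟧-sum n (λ i → f (suc i))))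

  apply : ∀ {n} → Adj n → (Fin n → Carrier) → Fin n → Carrier
  apply G x i = sum (λ j → adjMatrix F G i j * x j)

  apply-⟦+⟧ : ∀ {n} (G : Adj n) (f : Fin n → ℕ) i →
              apply G (λ j → ⟦ + f j ⟧) i ≡ ⟦ + sumℕ n (λ j → if G i j then f j else 0) ⟧
  apply-⟦+⟧ {n} G f i = trans (sum-cong-≗ entry) (sym (⟦+⟧-sum n _))
    where
    entry : ∀ j → adjMatrix F G i j * ⟦ + f j ⟧ ≡ ⟦ + (if G i j then f j else 0) ⟧
    entry j with G i j
    ... | true  = *-identity _
    ... | false = zeroˡ _

  apply-selfAdjoint : ∀ {n} (G : Adj n) → (∀ u v → G u v ≡ G v u) → ∀ (y z : Fin n → Carrier) →
                      sum (λ i → z i * apply G y i) ≡ sum (λ i → apply G z i * y i)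
  apply-selfAdjoint G symmetric y z = begin
    sum (λ i → z i * sum (λ j → A i j * y j))    ≡⟨ sum-cong-≗ (λ i → *-distribˡ-sum (z i) (λ j → A i j * y j)) ⟩
    sum (λ i → sum (λ j → z i * (A i j * y j)))  ≡⟨ ∑-comm (λ i j → z i * (A i j * y j)) ⟩
    sum (λ j → sum (λ i → z i * (A i j * y j)))  ≡⟨ sum-cong-≗ (λ j → sum-cong-≗ (λ i → entry i j)) ⟩
    sum (λ j → sum (λ i → (A j i * z i) * y j))  ≡⟨ sum-cong-≗ (λ j → sym (*-distribʳ-sum (y j) (λ i → A j i * z i))) ⟩
    sum (λ j → sum (λ i → A j i * z i) * y j)    ∎
    where
    open ≡-Reasoning
    A = adjMatrix F G
    entry : ∀ i j → z i * (A i j * y j) ≡ (A j i * z i) * y j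
    entry i j = trans (cong (λ b → z i * ((if b then 1# else 0#) * y j)) (symmetric i j))
                      (solve 3 (λ z a y → z :* (a :* y) := (a :* z) :* y) refl (z i) (A j i) (y j))

  module _ {n} {G : Adj n} (symmetric : ∀ u v → G u v ≡ G v u)
           {x : Fin n → Carrier} {μ : Carrier} (eigen : ∀ i → apply G x i ≡ μ * x i) where

    moment : ∀ z → sum (λ i → apply G z i * x i) ≡ μ * sum (λ i → z i * x i)
    moment z = begin
      sum (λ i → apply G z i * x i)  ≡⟨ sym (apply-selfAdjoint G symmetric x z) ⟩
      sum (λ i → z i * apply G x i)  ≡⟨ sum-cong-≗ (λ i → cong (_*_ (z i)) (eigen i)) ⟩
      sum (λ i → z i * (μ * x i))    ≡⟨ sum-cong-≗ (λ i → swap (z i) (x i)) ⟩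
      sum (λ i → μ * (z i * x i))    ≡⟨ sym (*-distribˡ-sum μ (λ i → z i * x i)) ⟩
      μ * sum (λ i → z i * x i)      ∎
      where
      open ≡-Reasoning
      swap : ∀ w y → w * (μ * y) ≡ μ * (w * y)
      swap w y = solve 3 (λ w μ y → w :* (μ :* y) := μ :* (w :* y)) refl w μ y

    degree-moment : sum (λ i → ⟦ + degree G i ⟧ * x i) ≡ μ * sum x
    degree-moment = begin
      sum (λ i → ⟦ + degree G i ⟧ * x i)    ≡⟨ sum-cong-≗ (λ i → cong (_* x i) (sym (apply-⟦+⟧ G (λ _ → 1) i))) ⟩
      sum (λ i → apply G (λ _ → 1#) i * x i) ≡⟨ moment (λ _ → 1#) ⟩
      μ * sum (λ i → 1# * x i)               ≡⟨ cong (_*_ μ) (sum-cong-≗ (λ i → *-identity (x i))) ⟩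
      μ * sum x                              ∎
      where open ≡-Reasoning

  private
    eigen-sum : ∀ {n} {G : Adj n} {μ} ((x , eig , _) : IsMainEigenvalue F G μ) → ∀ i → apply G x i ≡ μ * x i
    eigen-sum {n} (x , eig , _) i = trans (sym (sumF≡sum n _)) (eig i)

    sum≢0 : ∀ {n} {G : Adj n} {μ} ((x , _ , nz) : IsMainEigenvalue F G μ) → sum x ≢ 0#
    sum≢0 {n} (x , _ , nz) = nz ∘ trans (sumF≡sum n x)

  regular-mainEigenvalue : ∀ {n} {G : Adj n} → (∀ u v → G u v ≡ G v u) → ∀ k → (∀ v → degree G v ≡ k) →
                           ∀ {μ} → IsMainEigenvalue F G μ → μ ≡ ⟦ + k ⟧
  regular-mainEigenvalue {G = G} symmetric k regular {μ} main@(x , _) = *-cancelʳ-≢0 (sum≢0 main) (begin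
    μ * sum x                            ≡⟨ sym (degree-moment symmetric (eigen-sum main)) ⟩
    sum (λ i → ⟦ + degree G i ⟧ * x i)   ≡⟨ sum-cong-≗ (λ i → cong (λ d → ⟦ + d ⟧ * x i) (regular i)) ⟩
    sum (λ i → ⟦ + k ⟧ * x i)            ≡⟨ sym (*-distribˡ-sum ⟦ + k ⟧ x) ⟩
    ⟦ + k ⟧ * sum x                      ∎)
    where open ≡-Reasoning

  degreeCondition-⟦⟧ : ∀ {a b n} {G : Adj n} → DegreeCondition a b G →
                       ∀ v → ⟦ + neighbourDegreeSum G v ⟧ ≡ ⟦ a ⟧ * ⟦ + degree G v ⟧ + ⟦ b ⟧
  degreeCondition-⟦⟧ {a} {b} {G = G} cond v =
    trans (cong ⟦_⟧ (cond v)) (trans (+-homo (a ℤ.* + degree G v) b) (cong (_+ ⟦ b ⟧) (*-homo a (+ degree G v))))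

  sum-affine : ∀ {n} p q (f x : Fin n → Carrier) →
               sum (λ i → (p * f i + q) * x i) ≡ p * sum (λ i → f i * x i) + q * sum x
  sum-affine p q f x = begin
    sum (λ i → (p * f i + q) * x i)                    ≡⟨ sum-cong-≗ (λ i → expand (f i) (x i)) ⟩
    sum (λ i → p * (f i * x i) + q * x i)              ≡⟨ ∑-distrib-+ (λ i → p * (f i * x i)) (λ i → q * x i) ⟩
    sum (λ i → p * (f i * x i)) + sum (λ i → q * x i)  ≡⟨ sym (cong₂ _+_ (*-distribˡ-sum p (λ i → f i * x i))
                                                                          (*-distribˡ-sum q x)) ⟩
    p * sum (λ i → f i * x i) + q * sum x              ∎
    where
    open ≡-Reasoning
    expand : ∀ y z → (p * y + q) * z ≡ p * (y * z) + q * z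
    expand y z = solve 4 (λ p y q z → (p :* y :+ q) :* z := p :* (y :* z) :+ q :* z) refl p y q z

  sum-linear : ∀ {n} (f g : Fin n → Carrier) c → sum (λ i → f i - c * g i) ≡ sum f - c * sum g
  sum-linear f g c = begin
    sum (λ i → f i - c * g i)        ≡⟨ ∑-distrib-+ f (λ i → - (c * g i)) ⟩
    sum f + sum (λ i → - (c * g i))  ≡⟨ cong (_+_ (sum f)) (sum-cong-≗ (λ i → -c*x (g i))) ⟩
    sum f + sum (λ i → (- c) * g i)  ≡⟨ cong (_+_ (sum f)) (sym (*-distribˡ-sum (- c) g)) ⟩
    sum f + (- c) * sum g            ≡⟨ cong (_+_ (sum f)) (sym (-c*x (sum g))) ⟩
    sum f - c * sum g                ∎
    where
    open ≡-Reasoning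
    -c*x : ∀ x → - (c * x) ≡ (- c) * x
    -c*x x = solve 2 (λ c x → :- (c :* x) := (:- c) :* x) refl c x

  -- the all-ones vector 1 satisfies A² 1 = a A 1 + b 1, which forces μ² = a μ + b on main eigenvalues
  mainEigenvalue-quadratic : ∀ {a b n} {G : Adj n} → (∀ u v → G u v ≡ G v u) → DegreeCondition a b G →
                             ∀ {μ} → IsMainEigenvalue F G μ → μ * μ ≡ ⟦ a ⟧ * μ + ⟦ b ⟧
  mainEigenvalue-quadratic {a} {b} {G = G} symmetric cond {μ} main@(x , _) =
    *-cancelʳ-≢0 (sum≢0 main) (begin
      (μ * μ) * S                              ≡⟨ *-assoc μ μ S ⟩
      μ * (μ * S)                              ≡⟨ cong (_*_ μ) (sym T≡μS) ⟩
      μ * T                                    ≡⟨ sym (moment symmetric eigen d) ⟩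
      sum (λ i → apply G d i * x i)            ≡⟨ sum-cong-≗ (λ i → cong (_* x i) (Ad≡ i)) ⟩
      sum (λ i → (⟦ a ⟧ * d i + ⟦ b ⟧) * x i)  ≡⟨ sum-affine ⟦ a ⟧ ⟦ b ⟧ d x ⟩
      ⟦ a ⟧ * T + ⟦ b ⟧ * S                    ≡⟨ cong (λ t → ⟦ a ⟧ * t + ⟦ b ⟧ * S) T≡μS ⟩
      ⟦ a ⟧ * (μ * S) + ⟦ b ⟧ * S              ≡⟨ solve 4 (λ a μ S b → a :* (μ :* S) :+ b :* S := (a :* μ :+ b) :* S)
                                                          refl ⟦ a ⟧ μ S ⟦ b ⟧ ⟩
      (⟦ a ⟧ * μ + ⟦ b ⟧) * S                  ∎)
    where
    open ≡-Reasoning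
    eigen = eigen-sum main
    S = sum x
    d = λ i → ⟦ + degree G i ⟧
    T = sum (λ i → d i * x i)
    T≡μS : T ≡ μ * S
    T≡μS = degree-moment symmetric eigen
    Ad≡ : ∀ i → apply G d i ≡ ⟦ a ⟧ * d i + ⟦ b ⟧
    Ad≡ i = trans (apply-⟦+⟧ G (degree G) i) (degreeCondition-⟦⟧ {a} {b} cond i)

  sum-ones : ∀ n → sum {n} (λ _ → 1#) ≡ ⟦ + n ⟧
  sum-ones zero    = refl
  sum-ones (suc n) = trans (cong (_+_ 1#) (sum-ones n)) (sym (1+× n 1#))

  record QuadraticRoots (a b : Carrier) : Set where
    field
      r₁ r₂ : Carrier
      r₁+r₂ : r₁ + r₂ ≡ a
      r₁r₂  : r₁ * r₂ ≡ - b
      r₁≢r₂ : r₁ ≢ r₂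

  -- the roots (A ± s) / 2, for s a square root of the discriminant
  roots-from-discriminant : ∀ {A B s h} → s * s ≡ A * A + ⟦ + 4 ⟧ * B → ⟦ + 2 ⟧ * h ≡ 1# → s ≢ 0# →
                            QuadraticRoots A B
  roots-from-discriminant {A} {B} {s} {h} s²≡Δ 2h≡1 s≢0 = record
    { r₁ = (A + s) * h ; r₂ = (A - s) * h ; r₁+r₂ = sum-of-roots ; r₁r₂ = product-of-roots ; r₁≢r₂ = distinct }
    where
    open ≡-Reasoning
    sum-of-roots : (A + s) * h + (A - s) * h ≡ A
    sum-of-roots = begin
      (A + s) * h + (A - s) * h  ≡⟨ solve 3 (λ A s h → (A :+ s) :* h :+ (A :- s) :* h := A :* (con (+ 2) :* h))
                                            refl A s h ⟩
      A * (⟦ + 2 ⟧ * h)          ≡⟨ cong (_*_ A) 2h≡1 ⟩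
      A * 1#                     ≡⟨ *-identityʳ A ⟩
      A                          ∎
    product-of-roots : (A + s) * h * ((A - s) * h) ≡ - B
    product-of-roots = begin
      (A + s) * h * ((A - s) * h)                ≡⟨ solve 3 (λ A s h → (A :+ s) :* h :* ((A :- s) :* h)
                                                                    := (A :* A :- s :* s) :* (h :* h)) refl A s h ⟩
      (A * A - s * s) * (h * h)                  ≡⟨ cong (λ t → (A * A - t) * (h * h)) s²≡Δ ⟩
      (A * A - (A * A + ⟦ + 4 ⟧ * B)) * (h * h)  ≡⟨ solve 3 (λ A B h → (A :* A :- (A :* A :+ con (+ 4) :* B)) :* (h :* h)
                                                                    := :- B :* ((con (+ 2) :* h) :* (con (+ 2) :* h))) refl A B h ⟩
      - B * ((⟦ + 2 ⟧ * h) * (⟦ + 2 ⟧ * h))       ≡⟨ cong (λ t → - B * (t * t)) 2h≡1 ⟩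
      - B * (1# * 1#)                            ≡⟨ cong (_*_ (- B)) (*-identity 1#) ⟩
      - B * 1#                                   ≡⟨ *-identityʳ (- B) ⟩
      - B                                        ∎
    distinct : (A + s) * h ≢ (A - s) * h
    distinct r₁≡r₂ = s≢0 (begin
      s                          ≡⟨ sym (*-identityʳ s) ⟩
      s * 1#                     ≡⟨ cong (_*_ s) (sym 2h≡1) ⟩
      s * (⟦ + 2 ⟧ * h)          ≡⟨ solve 3 (λ A s h → s :* (con (+ 2) :* h) := (A :+ s) :* h :- (A :- s) :* h)
                                            refl A s h ⟩
      (A + s) * h - (A - s) * h  ≡⟨ x≈y⇒x∙y⁻¹≈ε r₁≡r₂ ⟩
      0#                         ∎)

  quadraticRoots : ∀ a b → b ≢ 0 → QuadraticRoots ⟦ + a ⟧ ⟦ + b ⟧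
  quadraticRoots a b b≢0 = roots-from-discriminant s²≡Δ (proj₂ half) s≢0
    where
    Δ = a ℕ.* a ℕ.+ 4 ℕ.* b
    root = sqrt ⟦ + Δ ⟧ (0≤×1# Δ)
    s = proj₁ root
    half = inverse ⟦ + 2 ⟧ (1+n×1#≢0 1)
    s²≡Δ : s * s ≡ ⟦ + a ⟧ * ⟦ + a ⟧ + ⟦ + 4 ⟧ * ⟦ + b ⟧
    s²≡Δ = trans (proj₂ root) (trans (×-homo-+ 1# (a ℕ.* a) (4 ℕ.* b)) (cong₂ _+_ (×1-homo-* a a) (×1-homo-* 4 b)))
    s≢0 : s ≢ 0#
    s≢0 s≡0 = b≢0 (4b≡0⇒b≡0 b (ℕ.m+n≡0⇒n≡0 (a ℕ.* a) (×1#-injective Δ 0 Δ≡0)))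
      where
      Δ≡0 : ⟦ + Δ ⟧ ≡ 0#
      Δ≡0 = trans (sym (proj₂ root)) (trans (cong (λ t → t * t) s≡0) (zeroˡ 0#))
      4b≡0⇒b≡0 : ∀ b → 4 ℕ.* b ≡ 0 → b ≡ 0
      4b≡0⇒b≡0 zero    _  = refl
      4b≡0⇒b≡0 (suc _) ()

  mainEigenvalue-root : ∀ {a b n} {G : Adj n} → (∀ u v → G u v ≡ G v u) → DegreeCondition a b G →
                        (roots : QuadraticRoots ⟦ a ⟧ ⟦ b ⟧) → ∀ {μ} → IsMainEigenvalue F G μ →
                        μ ≡ QuadraticRoots.r₁ roots ⊎ μ ≡ QuadraticRoots.r₂ roots
  mainEigenvalue-root {a} {b} symmetric cond roots {μ} main = product-roots r₁≢r₂ (begin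
    (μ - r₁) * (μ - r₂)              ≡⟨ solve 3 (λ μ r₁ r₂ → (μ :- r₁) :* (μ :- r₂) := μ :* μ :- (r₁ :+ r₂) :* μ :+ r₁ :* r₂)
                                                refl μ r₁ r₂ ⟩
    μ * μ - (r₁ + r₂) * μ + r₁ * r₂  ≡⟨ cong₂ (λ p q → μ * μ - p * μ + q) r₁+r₂ r₁r₂ ⟩
    μ * μ - ⟦ a ⟧ * μ + - ⟦ b ⟧              ≡⟨ cong (λ t → t - ⟦ a ⟧ * μ + - ⟦ b ⟧)
                                                      (mainEigenvalue-quadratic {a} {b} symmetric cond main) ⟩
    ⟦ a ⟧ * μ + ⟦ b ⟧ - ⟦ a ⟧ * μ + - ⟦ b ⟧  ≡⟨ solve 3 (λ a μ b → a :* μ :+ b :- a :* μ :+ :- b := con (+ 0))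
                                                      refl ⟦ a ⟧ μ ⟦ b ⟧ ⟩
    0#                                       ∎)
    where
    open QuadraticRoots roots
    open ≡-Reasoning

  private
    apply-shift : ∀ {n} (G : Adj n) (f : Fin n → Carrier) c i →
                  apply G (λ j → f j - c) i ≡ apply G f i - c * ⟦ + degree G i ⟧
    apply-shift {n} G f c i = begin
      sum (λ j → A i j * (f j - c))               ≡⟨ sum-cong-≗ (λ j → expand (A i j) (f j)) ⟩
      sum (λ j → A i j * f j - c * (A i j * 1#))  ≡⟨ sum-linear (λ j → A i j * f j) (λ j → A i j * 1#) c ⟩
      apply G f i - c * apply G (λ _ → 1#) i      ≡⟨ cong (λ t → apply G f i - c * t) (apply-⟦+⟧ G (λ _ → 1) i) ⟩
      apply G f i - c * ⟦ + degree G i ⟧          ∎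
      where
      open ≡-Reasoning
      A = adjMatrix F G
      expand : ∀ a y → a * (y - c) ≡ a * y - c * (a * 1#)
      expand a y = solve 3 (λ a y c → a :* (y :- c) := a :* y :- c :* (a :* con (+ 1))) refl a y c

  shiftedDegree-eigenvector : ∀ {a b n} {G : Adj n} → DegreeCondition a b G → ∀ {r r′} →
    r + r′ ≡ ⟦ a ⟧ → r * r′ ≡ - ⟦ b ⟧ →
    ∀ i → apply G (λ v → ⟦ + degree G v ⟧ - r′) i ≡ r * (⟦ + degree G i ⟧ - r′)
  shiftedDegree-eigenvector {a} {b} {G = G} cond {r} {r′} r+r′ rr′ i = begin
    apply G (λ v → d v - r′) i               ≡⟨ apply-shift G d r′ i ⟩
    apply G d i - r′ * d i                   ≡⟨ cong (λ t → t - r′ * d i) (trans (apply-⟦+⟧ G (degree G) i)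
                                                                                 (degreeCondition-⟦⟧ {a} {b} cond i)) ⟩
    ⟦ a ⟧ * d i + ⟦ b ⟧ - r′ * d i           ≡⟨ cong₂ (λ p q → p * d i + q - r′ * d i) (sym r+r′) b≡-rr′ ⟩
    (r + r′) * d i + - (r * r′) - r′ * d i   ≡⟨ solve 3 (λ r r′ d → (r :+ r′) :* d :+ :- (r :* r′) :- r′ :* d := r :* (d :- r′))
                                                        refl r r′ (d i) ⟩
    r * (d i - r′)                           ∎
    where
    open ≡-Reasoning
    d = λ v → ⟦ + degree G v ⟧
    b≡-rr′ : ⟦ b ⟧ ≡ - (r * r′)
    b≡-rr′ = trans (sym (⁻¹-involutive ⟦ b ⟧)) (cong -_ (sym rr′))

  private
    root-average : ∀ a b n D {r} → r * r ≡ ⟦ + a ⟧ * r + ⟦ + b ⟧ → ⟦ + D ⟧ ≡ r * ⟦ + n ⟧ →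
                   ¬ AverageIsNotRoot a b n D
    root-average a b n D {r} r² D≡rN not-root = not-root (×1#-injective _ _ (begin
      ⟦ + (D ℕ.* D) ⟧                              ≡⟨ ×1-homo-* D D ⟩
      ⟦ + D ⟧ * ⟦ + D ⟧                            ≡⟨ cong (λ t → t * t) D≡rN ⟩
      (r * N) * (r * N)                            ≡⟨ solve 2 (λ r N → (r :* N) :* (r :* N) := (r :* r) :* (N :* N)) refl r N ⟩
      (r * r) * (N * N)                            ≡⟨ cong (_* (N * N)) r² ⟩
      (A * r + B) * (N * N)                        ≡⟨ solve 4 (λ A r B N → (A :* r :+ B) :* (N :* N)
                                                                          := (A :* N) :* (r :* N) :+ B :* (N :* N)) refl A r B N ⟩
      (A * N) * (r * N) + B * (N * N)              ≡⟨ cong (λ t → (A * N) * t + B * (N * N)) (sym D≡rN) ⟩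
      (A * N) * ⟦ + D ⟧ + B * (N * N)              ≡⟨ sym (cong₂ _+_ (trans (×1-homo-* (a ℕ.* n) D) (cong (_* ⟦ + D ⟧) (×1-homo-* a n)))
                                                                     (trans (×1-homo-* b (n ℕ.* n)) (cong (_*_ B) (×1-homo-* n n)))) ⟩
      ⟦ + (a ℕ.* n ℕ.* D) ⟧ + ⟦ + (b ℕ.* (n ℕ.* n)) ⟧ ≡⟨ sym (×-homo-+ 1# (a ℕ.* n ℕ.* D) (b ℕ.* (n ℕ.* n))) ⟩
      ⟦ + (a ℕ.* n ℕ.* D ℕ.+ b ℕ.* (n ℕ.* n)) ⟧     ∎))
      where
      open ≡-Reasoning
      A = ⟦ + a ⟧
      B = ⟦ + b ⟧
      N = ⟦ + n ⟧

  shiftedDegree-mainEigenvalue : ∀ {a b n} {G : Adj n} → DegreeCondition (+ a) (+ b) G →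
    AverageIsNotRoot a b n (sumℕ n (degree G)) → ∀ {r r′} → r + r′ ≡ ⟦ + a ⟧ → r * r′ ≡ - ⟦ + b ⟧ →
    IsMainEigenvalue F G r
  shiftedDegree-mainEigenvalue {a} {b} {n} {G} cond not-root {r} {r′} r+r′ rr′ =
    y , (λ i → trans (sumF≡sum n _) (shiftedDegree-eigenvector {+ a} {+ b} cond r+r′ rr′ i)) , entrySum≢0
    where
    open ≡-Reasoning
    y = λ v → ⟦ + degree G v ⟧ - r′
    sum-y : sum y ≡ ⟦ + sumℕ n (degree G) ⟧ - r′ * ⟦ + n ⟧
    sum-y = begin
      sum y                                                  ≡⟨ sum-cong-≗ (λ v → cong (λ t → ⟦ + degree G v ⟧ - t) (sym (*-identityʳ r′))) ⟩
      sum (λ v → ⟦ + degree G v ⟧ - r′ * 1#)                 ≡⟨ sum-linear (λ v → ⟦ + degree G v ⟧) (λ _ → 1#) r′ ⟩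
      sum (λ v → ⟦ + degree G v ⟧) - r′ * sum {n} (λ _ → 1#) ≡⟨ sym (cong₂ (λ p q → p - r′ * q) (⟦+⟧-sum n (degree G))
                                                                                             (sym (sum-ones n))) ⟩
      ⟦ + sumℕ n (degree G) ⟧ - r′ * ⟦ + n ⟧                 ∎
    r′² : r′ * r′ ≡ ⟦ + a ⟧ * r′ + ⟦ + b ⟧
    r′² = begin
      r′ * r′                    ≡⟨ solve 2 (λ r r′ → r′ :* r′ := (r :+ r′) :* r′ :- r :* r′) refl r r′ ⟩
      (r + r′) * r′ - r * r′     ≡⟨ cong₂ (λ p q → p * r′ - q) r+r′ rr′ ⟩
      ⟦ + a ⟧ * r′ - - ⟦ + b ⟧   ≡⟨ cong (_+_ (⟦ + a ⟧ * r′)) (⁻¹-involutive ⟦ + b ⟧) ⟩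
      ⟦ + a ⟧ * r′ + ⟦ + b ⟧     ∎
    entrySum≢0 : sumF F n y ≢ 0#
    entrySum≢0 sum≡0 = root-average a b n (sumℕ n (degree G)) r′² 
      (x∙y⁻¹≈ε⇒x≈y _ _ (trans (sym sum-y) (trans (sym (sumF≡sum n y)) sum≡0))) not-root

  twoMainEigenvalues : ∀ {n} {G : Adj n} a b → b ≢ 0 → (∀ u v → G u v ≡ G v u) →
    DegreeCondition (+ a) (+ b) G → AverageIsNotRoot a b n (sumℕ n (degree G)) →
    HasExactlyTwoMainEigenvalues F G
  twoMainEigenvalues a b b≢0 symmetric cond not-root =
      r₁ , r₂ , r₁≢r₂
    , shiftedDegree-mainEigenvalue {a} {b} cond not-root r₁+r₂ r₁r₂
    , shiftedDegree-mainEigenvalue {a} {b} cond not-root (trans (+-comm r₂ r₁) r₁+r₂) (trans (*-comm r₂ r₁) r₁r₂)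
    , λ μ → mainEigenvalue-root {+ a} {+ b} symmetric cond roots {μ}
    where
    roots = quadraticRoots a b b≢0
    open QuadraticRoots roots

  mainEigenvalue⇒vertex : ∀ {n} {G : Adj n} {μ} → IsMainEigenvalue F G μ → Fin n
  mainEigenvalue⇒vertex {zero}  (x , _ , nz) = ⊥-elim (nz refl)
  mainEigenvalue⇒vertex {suc n} _            = zero

-- Finite sums and counting

-- Opened only here: above, _+_, _*_, _≤_ and _×_ are the field operations and n × 1#.
open import Algebra.Properties.CommutativeSemigroup ℕ.+-commutativeSemigroup using (interchange)
open import Data.Nat using (_+_; _*_; _∸_; _≤_; _<_; z≤n; s≤s; _<ᵇ_)
open import Data.Product using (_×_)

sumℕ-cong : ∀ n {f g : Fin n → ℕ} → (∀ i → f i ≡ g i) → sumℕ n f ≡ sumℕ n g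
sumℕ-cong zero    f≗g = refl
sumℕ-cong (suc n) f≗g = cong₂ _+_ (f≗g zero) (sumℕ-cong n (f≗g ∘ suc))

sumℕ-distrib-+ : ∀ n (f g : Fin n → ℕ) → sumℕ n (λ i → f i + g i) ≡ sumℕ n f + sumℕ n g
sumℕ-distrib-+ zero    f g = refl
sumℕ-distrib-+ (suc n) f g = trans (cong (_+_ (f zero + g zero)) (sumℕ-distrib-+ n (f ∘ suc) (g ∘ suc)))
                                   (interchange (f zero) (g zero) _ _)

sumℕ-mono-≤ : ∀ n {f g : Fin n → ℕ} → (∀ i → f i ≤ g i) → sumℕ n f ≤ sumℕ n g
sumℕ-mono-≤ zero    f≤g = z≤n
sumℕ-mono-≤ (suc n) f≤g = ℕ.+-mono-≤ (f≤g zero) (sumℕ-mono-≤ n (f≤g ∘ suc))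

≤-sumℕ : ∀ n (f : Fin n → ℕ) i → f i ≤ sumℕ n f
≤-sumℕ (suc n) f zero    = ℕ.m≤m+n (f zero) _
≤-sumℕ (suc n) f (suc i) = ℕ.≤-trans (≤-sumℕ n (f ∘ suc) i) (ℕ.m≤n+m _ (f zero))

+-≤-sumℕ : ∀ n (f : Fin n → ℕ) {i j} → i ≢ j → f i + f j ≤ sumℕ n f
+-≤-sumℕ (suc n) f {zero}  {zero}  0≢0 = ⊥-elim (0≢0 refl)
+-≤-sumℕ (suc n) f {zero}  {suc j} _   = ℕ.+-monoʳ-≤ (f zero) (≤-sumℕ n (f ∘ suc) j)
+-≤-sumℕ (suc n) f {suc i} {zero}  _   =
  subst (_≤ sumℕ (suc n) f) (ℕ.+-comm (f zero) _) (ℕ.+-monoʳ-≤ (f zero) (≤-sumℕ n (f ∘ suc) i))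
+-≤-sumℕ (suc n) f {suc i} {suc j} i≢j =
  ℕ.≤-trans (+-≤-sumℕ n (f ∘ suc) (i≢j ∘ cong suc)) (ℕ.m≤n+m _ (f zero))

sumℕ-zero : ∀ n → sumℕ n (λ _ → 0) ≡ 0
sumℕ-zero zero    = refl
sumℕ-zero (suc n) = sumℕ-zero n

sumℕ-supported : ∀ n (f : Fin n → ℕ) i → (∀ j → j ≢ i → f j ≡ 0) → sumℕ n f ≡ f i
sumℕ-supported (suc n) f zero    outside = begin
  f zero + sumℕ n (f ∘ suc)    ≡⟨ cong (_+_ (f zero)) (sumℕ-cong n (λ j → outside (suc j) λ ())) ⟩
  f zero + sumℕ n (λ _ → 0)    ≡⟨ cong (_+_ (f zero)) (sumℕ-zero n) ⟩
  f zero + 0                   ≡⟨ ℕ.+-identityʳ (f zero) ⟩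
  f zero                       ∎
  where open ≡-Reasoning
sumℕ-supported (suc n) f (suc i) outside =
  cong₂ _+_ (outside zero λ ()) (sumℕ-supported n (f ∘ suc) i (λ j j≢i → outside (suc j) (j≢i ∘ suc-injective)))

sumℕ-positive : ∀ n (f : Fin n → ℕ) → 0 < sumℕ n f → ∃ λ i → 0 < f i
sumℕ-positive (suc n) f 0<sum with f zero in f0≡
... | suc _ = zero , subst (0 <_) (sym f0≡) (s≤s z≤n)
... | zero  = let i , 0<fi = sumℕ-positive n (f ∘ suc) 0<sum in suc i , 0<fi

sumℕ-permute : ∀ {m n} (π : Fin m ↔ Fin n) (f : Fin n → ℕ) → sumℕ m (f ∘ Inverse.to π) ≡ sumℕ n f
sumℕ-permute {m} {n} π f = trans (sumℕ≡sum m _) (trans (sym (sum-permute f π)) (sym (sumℕ≡sum n f)))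
  where
  open import Algebra.Properties.CommutativeMonoid.Sum ℕ.+-0-commutativeMonoid using (sum; sum-permute)
  sumℕ≡sum : ∀ k (g : Fin k → ℕ) → sumℕ k g ≡ sum g
  sumℕ≡sum zero    g = refl
  sumℕ≡sum (suc k) g = cong (_+_ (g zero)) (sumℕ≡sum k (g ∘ suc))

indicator : Bool → ℕ
indicator b = if b then 1 else 0

count : ∀ {n} → (Fin n → Bool) → ℕ
count {n} p = sumℕ n (λ x → indicator (p x))

except : ∀ {n} → (Fin n → Bool) → Fin n → Fin n → Bool
except p c x = p x ∧ not (does (x ≟ c))

except-true : ∀ {n} {p : Fin n → Bool} {c x} → except p c x ≡ true → p x ≡ true × x ≢ c
except-true {p = p} {c} {x} eq with p x | x ≟ c
except-true () | true  | yes _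
except-true () | false | _
... | true  | no x≢c = refl , x≢c

except-intro : ∀ {n} {p : Fin n → Bool} {c x} → p x ≡ true → x ≢ c → except p c x ≡ true
except-intro {c = c} {x} px x≢c with x ≟ c
... | yes x≡c = ⊥-elim (x≢c x≡c)
... | no _    = trans (∧-identityʳ _) px

count-singleton : ∀ {n} (c : Fin n) → count (λ x → does (x ≟ c)) ≡ 1
count-singleton {suc n} zero    = cong suc (sumℕ-zero n)
count-singleton {suc n} (suc c) = count-singleton c

count-except : ∀ {n} (p : Fin n → Bool) {c} → p c ≡ true → count p ≡ suc (count (except p c))
count-except {n} p {c} pc = begin
  count p                                                    ≡⟨ sumℕ-cong n split ⟩
  sumℕ n (λ x → indicator (except p c x) + indicator (does (x ≟ c))) ≡⟨ sumℕ-distrib-+ n _ _ ⟩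
  count (except p c) + count (λ x → does (x ≟ c))           ≡⟨ cong (_+_ (count (except p c))) (count-singleton c) ⟩
  count (except p c) + 1                                     ≡⟨ ℕ.+-comm _ 1 ⟩
  suc (count (except p c))                                   ∎
  where
  open ≡-Reasoning
  split : ∀ x → indicator (p x) ≡ indicator (except p c x) + indicator (does (x ≟ c))
  split x with x ≟ c
  ... | yes refl = trans (cong indicator pc) (cong (λ b → indicator (b ∧ false) + 1) (sym pc))
  ... | no _     = trans (cong indicator (sym (∧-identityʳ (p x)))) (sym (ℕ.+-identityʳ _))

private
  prependZero : ∀ {n m} b → (Fin m → Fin n) → Fin (indicator b + m) → Fin (suc n)
  prependZero true  e zero    = zero
  prependZero true  e (suc i) = suc (e i)
  prependZero false e i       = suc (e i)

enum : ∀ {n} (p : Fin n → Bool) → Fin (count p) → Fin n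
enum {suc n} p = prependZero (p zero) (enum (p ∘ suc))

enum-injective : ∀ {n} (p : Fin n → Bool) → Injective _≡_ _≡_ (enum p)
enum-injective {suc n} p = prependZero-injective (p zero) (enum-injective (p ∘ suc))
  where
  prependZero-injective : ∀ {m} {e : Fin m → Fin n} b → Injective _≡_ _≡_ e → Injective _≡_ _≡_ (prependZero b e)
  prependZero-injective true  inj {zero}  {zero}  _  = refl
  prependZero-injective true  inj {suc i} {suc j} eq = cong suc (inj (suc-injective eq))
  prependZero-injective false inj                 eq = inj (suc-injective eq)

enum-sound : ∀ {n} (p : Fin n → Bool) i → p (enum p i) ≡ true
enum-sound {suc n} p = prependZero-sound (p zero) refl (enum-sound (p ∘ suc))
  where
  prependZero-sound : ∀ {m} {e : Fin m → Fin n} b → p zero ≡ b → (∀ i → p (suc (e i)) ≡ true) →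
                 ∀ i → p (prependZero b e i) ≡ true
  prependZero-sound true  p0 sound zero    = p0
  prependZero-sound true  p0 sound (suc i) = sound i
  prependZero-sound false p0 sound i       = sound i

enum-complete : ∀ {n} (p : Fin n → Bool) {x} → p x ≡ true → ∃ λ i → enum p i ≡ x
enum-complete {suc n} p = prependZero-complete (p zero) refl (enum-complete (p ∘ suc))
  where
  prependZero-complete : ∀ {m} {e : Fin m → Fin n} b → p zero ≡ b →
                    (∀ {x} → p (suc x) ≡ true → ∃ λ i → e i ≡ x) →
                    ∀ {x} → p x ≡ true → ∃ λ i → prependZero b e i ≡ x
  prependZero-complete true  p0 complete {zero}  px = zero , refl
  prependZero-complete false p0 complete {zero}  px = case trans (sym p0) px of λ ()
  prependZero-complete true  p0 complete {suc x} px = let i , eq = complete px in suc i , cong suc eq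
  prependZero-complete false p0 complete {suc x} px = let i , eq = complete px in i , cong suc eq

count≡0 : ∀ {n} (p : Fin n → Bool) → count p ≡ 0 → ∀ x → p x ≡ false
count≡0 p empty x with p x in px
... | false = refl
... | true  = case subst Fin empty (proj₁ (enum-complete p px)) of λ ()

count≡1 : ∀ {n} (p : Fin n → Bool) → count p ≡ 1 → ∀ {x y} → p x ≡ true → p y ≡ true → x ≡ y
count≡1 p single px py with enum-complete p px | enum-complete p py
... | i , refl | j , refl = cong (enum p) (unique single i j)
  where
  unique : ∀ {m} → m ≡ 1 → (i j : Fin m) → i ≡ j
  unique refl zero zero = refl

count-positive : ∀ {n} (p : Fin n → Bool) → 0 < count p → ∃ λ x → p x ≡ true
count-positive {n} p 0<count with sumℕ-positive n (indicator ∘ p) 0<count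
... | x , 0<px with p x in px
...   | true  = x , px
...   | false = case 0<px of λ ()

-- Walks and isomorphisms

adjacent⇒≢ : ∀ {n} {G : Adj n} → (∀ x → G x x ≡ false) → ∀ {x y} → G x y ≡ true → x ≢ y
adjacent⇒≢ loopless {x} xy refl = case trans (sym xy) (loopless x) of λ ()

walk-invariant : ∀ {n} {G : Adj n} (P : Fin n → Set) → (∀ {x y} → G x y ≡ true → P x → P y) →
                 ∀ {x y} → Walk G x y → P x → P y
walk-invariant P step-P here          Px = Px
walk-invariant P step-P (step xw walk) Px = walk-invariant P step-P walk (step-P xw Px)

_++ʷ_ : ∀ {n} {G : Adj n} {x y z} → Walk G x y → Walk G y z → Walk G x z
here        ++ʷ walk′ = walk′
step e walk ++ʷ walk′ = step e (walk ++ʷ walk′)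

reverse : ∀ {n} {G : Adj n} → (∀ x y → G x y ≡ G y x) → ∀ {x y} → Walk G x y → Walk G y x
reverse symmetric here               = here
reverse symmetric (step {w = w} e walk) = reverse symmetric walk ++ʷ step (trans (symmetric w _) e) here

connected-via : ∀ {n} {G : Adj n} → (∀ x y → G x y ≡ G y x) → ∀ c → (∀ x → Walk G x c) → Connected G
connected-via symmetric c reach x y = reach x ++ʷ reverse symmetric (reach y)

≅-from-enumeration : ∀ {n k} (G : Adj n) (H : Adj k) (g : Fin k → Fin n) → Injective _≡_ _≡_ g →
                     (∀ x → ∃ λ i → g i ≡ x) → (∀ i j → G (g i) (g j) ≡ H i j) → G ≅ H
≅-from-enumeration G H g injective surjective adjacency =
  mk↔ₛ′ index g (λ i → injective (proj₂ (surjective (g i)))) (proj₂ ∘ surjective) , preserves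
  where
  index = proj₁ ∘ surjective
  preserves : ∀ x y → G x y ≡ H (index x) (index y)
  preserves x y = trans (sym (cong₂ G (proj₂ (surjective x)) (proj₂ (surjective y)))) (adjacency (index x) (index y))

module Isomorphism {n m} {G : Adj n} {H : Adj m} (iso : G ≅ H) where

  private
    π = proj₁ iso
    to = Inverse.to π
    from = Inverse.from π
    preserves = proj₂ iso

  degree-≅ : ∀ x → degree G x ≡ degree H (to x)
  degree-≅ x = trans (sumℕ-cong n (λ y → cong indicator (preserves x y))) (sumℕ-permute π (indicator ∘ H (to x)))

  neighbourDegreeSum-≅ : ∀ x → neighbourDegreeSum G x ≡ neighbourDegreeSum H (to x)
  neighbourDegreeSum-≅ x =
    trans (sumℕ-cong n (λ y → cong₂ (λ e k → if e then k else 0) (preserves x y) (degree-≅ y)))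
          (sumℕ-permute π (λ z → if H (to x) z then degree H z else 0))

  degreeSum-≅ : sumℕ n (degree G) ≡ sumℕ m (degree H)
  degreeSum-≅ = trans (sumℕ-cong n degree-≅) (sumℕ-permute π (degree H))

  connected-≅ : Connected H → Connected G
  connected-≅ connectedH x y = subst₂ (Walk G) (Inverse.strictlyInverseʳ π x) (Inverse.strictlyInverseʳ π y)
                                      (pullback (connectedH (to x) (to y)))
    where
    pullback : ∀ {z w} → Walk H z w → Walk G (from z) (from w)
    pullback here                        = here
    pullback {z} (step {w = w′} zw′ walk) =
      step (trans (preserves (from z) (from w′))
                  (trans (cong₂ H (Inverse.strictlyInverseˡ π z) (Inverse.strictlyInverseˡ π w′)) zw′))
           (pullback walk)

-- Double stars

data Role : Set where
  centreU centreV leafU leafV : Role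

linked : Role → Role → Bool
linked centreU centreV = true
linked centreU leafU   = true
linked centreV leafV   = true
linked _       _       = false

roleAdj : Role → Role → Bool
roleAdj r s = linked r s ∨ linked s r

roleAdj-symmetric : ∀ r s → roleAdj r s ≡ roleAdj s r
roleAdj-symmetric r s = ∨-comm (linked r s) (linked s r)

role : ℕ → ℕ → Role
role k₁ zero          = centreU
role k₁ (suc zero)    = centreV
role k₁ (suc (suc t)) = if t <ᵇ k₁ then leafU else leafV

doubleStar-role : ∀ k₁ k₂ (i j : Fin (2 + k₁ + k₂)) →
                  doubleStar k₁ k₂ i j ≡ roleAdj (role k₁ (toℕ i)) (role k₁ (toℕ j))
doubleStar-role k₁ k₂ zero          zero          = refl
doubleStar-role k₁ k₂ zero          (suc zero)    = refl
doubleStar-role k₁ k₂ (suc zero)    zero          = refl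
doubleStar-role k₁ k₂ (suc zero)    (suc zero)    = refl
doubleStar-role k₁ k₂ zero          (suc (suc j)) with toℕ j <ᵇ k₁
... | true  = refl
... | false = refl
doubleStar-role k₁ k₂ (suc zero)    (suc (suc j)) with toℕ j <ᵇ k₁
... | true  = refl
... | false = refl
doubleStar-role k₁ k₂ (suc (suc i)) zero          with toℕ i <ᵇ k₁
... | true  = refl
... | false = refl
doubleStar-role k₁ k₂ (suc (suc i)) (suc zero)    with toℕ i <ᵇ k₁
... | true  = refl
... | false = refl
doubleStar-role k₁ k₂ (suc (suc i)) (suc (suc j)) with toℕ i <ᵇ k₁ | toℕ j <ᵇ k₁
... | true  | true  = refl
... | true  | false = refl
... | false | true  = refl
... | false | false = refl

data Position (k₁ k₂ : ℕ) : Fin (2 + k₁ + k₂) → Set where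
  atCentreU : Position k₁ k₂ zero
  atCentreV : Position k₁ k₂ (suc zero)
  atLeafU   : (a : Fin k₁) → Position k₁ k₂ (suc (suc (a ↑ˡ k₂)))
  atLeafV   : (b : Fin k₂) → Position k₁ k₂ (suc (suc (k₁ ↑ʳ b)))

position : ∀ {k₁ k₂} (i : Fin (2 + k₁ + k₂)) → Position k₁ k₂ i
position zero                    = atCentreU
position (suc zero)              = atCentreV
position {k₁} {k₂} (suc (suc i)) with splitAt k₁ i in eq
... | inj₁ a = subst (λ j → Position k₁ k₂ (suc (suc j))) (splitAt⁻¹-↑ˡ eq) (atLeafU a)
... | inj₂ b = subst (λ j → Position k₁ k₂ (suc (suc j))) (splitAt⁻¹-↑ʳ eq) (atLeafV b)

roleOf : ∀ {k₁ k₂ i} → Position k₁ k₂ i → Role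
roleOf atCentreU   = centreU
roleOf atCentreV   = centreV
roleOf (atLeafU _) = leafU
roleOf (atLeafV _) = leafV

role-position : ∀ {k₁ k₂ i} (p : Position k₁ k₂ i) → role k₁ (toℕ i) ≡ roleOf p
role-position             atCentreU   = refl
role-position             atCentreV   = refl
role-position {k₁} {k₂}   (atLeafU a) = cong (λ b → if b then leafU else leafV)
  (trans (cong (_<ᵇ k₁) (toℕ-↑ˡ a k₂)) (<⇒<ᵇ≡true (toℕ<n a)))
  where
  <⇒<ᵇ≡true : ∀ {m n} → m < n → (m <ᵇ n) ≡ true
  <⇒<ᵇ≡true {zero}  (s≤s _)   = refl
  <⇒<ᵇ≡true {suc m} (s≤s m<n) = <⇒<ᵇ≡true m<n
role-position {k₁}        (atLeafV b) = cong (λ b → if b then leafU else leafV)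
  (trans (cong (_<ᵇ k₁) (toℕ-↑ʳ k₁ b)) (+<ᵇ≡false k₁))
  where
  +<ᵇ≡false : ∀ m {t} → (m + t <ᵇ m) ≡ false
  +<ᵇ≡false zero    = refl
  +<ᵇ≡false (suc m) = +<ᵇ≡false m

doubleStar-symmetric : ∀ k₁ k₂ i j → doubleStar k₁ k₂ i j ≡ doubleStar k₁ k₂ j i
doubleStar-symmetric k₁ k₂ i j = trans (doubleStar-role k₁ k₂ i j)
  (trans (roleAdj-symmetric (role k₁ (toℕ i)) (role k₁ (toℕ j))) (sym (doubleStar-role k₁ k₂ j i)))

doubleStar-position : ∀ {k₁ k₂ i j} (p : Position k₁ k₂ i) (q : Position k₁ k₂ j) →
                      doubleStar k₁ k₂ i j ≡ roleAdj (roleOf p) (roleOf q)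
doubleStar-position {k₁} {k₂} {i} {j} p q =
  trans (doubleStar-role k₁ k₂ i j) (cong₂ roleAdj (role-position p) (role-position q))

doubleStar-connected : ∀ k₁ k₂ → Connected (doubleStar k₁ k₂)
doubleStar-connected k₁ k₂ = connected-via (doubleStar-symmetric k₁ k₂) zero reach
  where
  edge : ∀ {i j} (p : Position k₁ k₂ i) (q : Position k₁ k₂ j) → roleAdj (roleOf p) (roleOf q) ≡ true →
         doubleStar k₁ k₂ i j ≡ true
  edge p q pq = trans (doubleStar-position p q) pq
  reach : ∀ i → Walk (doubleStar k₁ k₂) i zero
  reach i with position {k₁} {k₂} i
  ... | atCentreU = here
  ... | atCentreV = step (edge atCentreV atCentreU refl) here
  ... | atLeafU a = step (edge (atLeafU a) atCentreU refl) here
  ... | atLeafV b = step {w = suc zero} (edge (atLeafV b) atCentreV refl)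
                         (step {w = zero} (edge atCentreV atCentreU refl) here)

module DoubleStarRecognition
  {n} {G : Adj n} (symmetric : ∀ x y → G x y ≡ G y x) (loopless : ∀ x → G x x ≡ false)
  (connected : Connected G) {u v : Fin n} (uv : G u v ≡ true)
  (leaves-u : ∀ x → G u x ≡ true → x ≢ v → degree G x ≡ 1)
  (leaves-v : ∀ x → G v x ≡ true → x ≢ u → degree G x ≡ 1)
  where

  private
    k₁ = count (except (G u) v)
    k₂ = count (except (G v) u)

    record Pendant (c c′ x : Fin n) : Set where
      field
        attached : G x c ≡ true
        ≢other   : x ≢ c′
        ≢centre  : x ≢ c
        only     : ∀ {y} → G x y ≡ true → y ≡ c

      avoids : ∀ {y} → y ≢ c → G x y ≡ false
      avoids {y} y≢c with G x y in xy
      ... | false = refl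
      ... | true  = ⊥-elim (y≢c (only xy))

    pendant : ∀ c c′ → (∀ x → G c x ≡ true → x ≢ c′ → degree G x ≡ 1) →
              ∀ {x} → except (G c) c′ x ≡ true → Pendant c c′ x
    pendant c c′ leaves {x} selected = record
      { attached = trans (symmetric x c) cx
      ; ≢other   = x≢c′
      ; ≢centre  = adjacent⇒≢ {G = G} loopless cx ∘ sym
      ; only     = λ xy → count≡1 (G x) (leaves x cx x≢c′) xy (trans (symmetric x c) cx)
      }
      where
      cx = proj₁ (except-true {p = G c} selected)
      x≢c′ = proj₂ (except-true {p = G c} selected)

    leafOfU : Fin k₁ → Fin n
    leafOfU = enum (except (G u) v)

    leafOfV : Fin k₂ → Fin n
    leafOfV = enum (except (G v) u)

    pendantU : ∀ a → Pendant u v (leafOfU a)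
    pendantU a = pendant u v leaves-u (enum-sound (except (G u) v) a)

    pendantV : ∀ b → Pendant v u (leafOfV b)
    pendantV b = pendant v u leaves-v (enum-sound (except (G v) u) b)

    u≢v : u ≢ v
    u≢v = adjacent⇒≢ {G = G} loopless uv

    vu : G v u ≡ true
    vu = trans (symmetric v u) uv

    vertexAt : ∀ {i} → Position k₁ k₂ i → Fin n
    vertexAt atCentreU   = u
    vertexAt atCentreV   = v
    vertexAt (atLeafU a) = leafOfU a
    vertexAt (atLeafV b) = leafOfV b

    vertex : Fin (2 + k₁ + k₂) → Fin n
    vertex zero          = u
    vertex (suc zero)    = v
    vertex (suc (suc i)) = [ leafOfU , leafOfV ]′ (splitAt k₁ i)

    vertex-position : ∀ {i} (p : Position k₁ k₂ i) → vertex i ≡ vertexAt p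
    vertex-position atCentreU   = refl
    vertex-position atCentreV   = refl
    vertex-position (atLeafU a) = cong [ leafOfU , leafOfV ]′ (splitAt-↑ˡ k₁ a k₂)
    vertex-position (atLeafV b) = cong [ leafOfU , leafOfV ]′ (splitAt-↑ʳ k₁ k₂ b)

    open Pendant

    leafOfU≢leafOfV : ∀ a b → leafOfU a ≢ leafOfV b
    leafOfU≢leafOfV a b eq = u≢v (only (pendantV b) (subst (λ x → G x u ≡ true) eq (attached (pendantU a))))

    vertexAt-injective : ∀ {i j} (p : Position k₁ k₂ i) (q : Position k₁ k₂ j) → vertexAt p ≡ vertexAt q → i ≡ j
    vertexAt-injective atCentreU   atCentreU    _  = refl
    vertexAt-injective atCentreU   atCentreV    eq = ⊥-elim (u≢v eq)
    vertexAt-injective atCentreU   (atLeafU a)  eq = ⊥-elim (≢centre (pendantU a) (sym eq))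
    vertexAt-injective atCentreU   (atLeafV b)  eq = ⊥-elim (≢other (pendantV b) (sym eq))
    vertexAt-injective atCentreV   atCentreU    eq = ⊥-elim (u≢v (sym eq))
    vertexAt-injective atCentreV   atCentreV    _  = refl
    vertexAt-injective atCentreV   (atLeafU a)  eq = ⊥-elim (≢other (pendantU a) (sym eq))
    vertexAt-injective atCentreV   (atLeafV b)  eq = ⊥-elim (≢centre (pendantV b) (sym eq))
    vertexAt-injective (atLeafU a) atCentreU    eq = ⊥-elim (≢centre (pendantU a) eq)
    vertexAt-injective (atLeafU a) atCentreV    eq = ⊥-elim (≢other (pendantU a) eq)
    vertexAt-injective (atLeafU a) (atLeafU a′) eq = cong (λ a → suc (suc (a ↑ˡ k₂))) (enum-injective _ eq)
    vertexAt-injective (atLeafU a) (atLeafV b)  eq = ⊥-elim (leafOfU≢leafOfV a b eq)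
    vertexAt-injective (atLeafV b) atCentreU    eq = ⊥-elim (≢other (pendantV b) eq)
    vertexAt-injective (atLeafV b) atCentreV    eq = ⊥-elim (≢centre (pendantV b) eq)
    vertexAt-injective (atLeafV b) (atLeafU a)  eq = ⊥-elim (leafOfU≢leafOfV a b (sym eq))
    vertexAt-injective (atLeafV b) (atLeafV b′) eq = cong (λ b → suc (suc (k₁ ↑ʳ b))) (enum-injective _ eq)

    adjacency : ∀ {i j} (p : Position k₁ k₂ i) (q : Position k₁ k₂ j) →
                G (vertexAt p) (vertexAt q) ≡ roleAdj (roleOf p) (roleOf q)
    adjacency atCentreU   atCentreU    = loopless u
    adjacency atCentreU   atCentreV    = uv
    adjacency atCentreU   (atLeafU a)  = trans (symmetric u _) (attached (pendantU a))
    adjacency atCentreU   (atLeafV b)  = trans (symmetric u _) (avoids (pendantV b) u≢v)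
    adjacency atCentreV   atCentreU    = vu
    adjacency atCentreV   atCentreV    = loopless v
    adjacency atCentreV   (atLeafU a)  = trans (symmetric v _) (avoids (pendantU a) (u≢v ∘ sym))
    adjacency atCentreV   (atLeafV b)  = trans (symmetric v _) (attached (pendantV b))
    adjacency (atLeafU a) atCentreU    = attached (pendantU a)
    adjacency (atLeafU a) atCentreV    = avoids (pendantU a) (u≢v ∘ sym)
    adjacency (atLeafU a) (atLeafU a′) = avoids (pendantU a) (≢centre (pendantU a′))
    adjacency (atLeafU a) (atLeafV b)  = avoids (pendantU a) (≢other (pendantV b))
    adjacency (atLeafV b) atCentreU    = avoids (pendantV b) u≢v
    adjacency (atLeafV b) atCentreV    = attached (pendantV b)
    adjacency (atLeafV b) (atLeafU a)  = avoids (pendantV b) (≢other (pendantU a))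
    adjacency (atLeafV b) (atLeafV b′) = avoids (pendantV b) (≢centre (pendantV b′))

    InImage : Fin n → Set
    InImage x = ∃ λ i → vertex i ≡ x

    neighbour-inImage : ∀ {i y} (p : Position k₁ k₂ i) → G (vertexAt p) y ≡ true → InImage y
    neighbour-inImage {y = y} atCentreU uy with y ≟ v
    ... | yes refl = suc zero , refl
    ... | no y≢v   = let a , eq = enum-complete (except (G u) v) (except-intro {p = G u} uy y≢v)
                     in suc (suc (a ↑ˡ k₂)) , trans (vertex-position (atLeafU a)) eq
    neighbour-inImage {y = y} atCentreV vy with y ≟ u
    ... | yes refl = zero , refl
    ... | no y≢u   = let b , eq = enum-complete (except (G v) u) (except-intro {p = G v} vy y≢u)
                     in suc (suc (k₁ ↑ʳ b)) , trans (vertex-position (atLeafV b)) eq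
    neighbour-inImage (atLeafU a) xy = zero , sym (only (pendantU a) xy)
    neighbour-inImage (atLeafV b) xy = suc zero , sym (only (pendantV b) xy)

    surjective : ∀ x → InImage x
    surjective x = walk-invariant InImage step-inImage (connected u x) (zero , refl)
      where
      step-inImage : ∀ {x y} → G x y ≡ true → InImage x → InImage y
      step-inImage xy (i , refl) =
        neighbour-inImage (position i) (subst (λ z → G z _ ≡ true) (vertex-position (position i)) xy)

  ≅-doubleStar : G ≅ doubleStar (count (except (G u) v)) (count (except (G v) u))
  ≅-doubleStar = ≅-from-enumeration G (doubleStar k₁ k₂) vertex injective surjective edges
    where
    injective : Injective _≡_ _≡_ vertex
    injective {i} {j} eq = vertexAt-injective (position i) (position j)
      (trans (sym (vertex-position (position i))) (trans eq (vertex-position (position j))))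
    edges : ∀ i j → G (vertex i) (vertex j) ≡ doubleStar k₁ k₂ i j
    edges i j = trans (cong₂ G (vertex-position p) (vertex-position q))
                      (trans (adjacency p q) (sym (doubleStar-position p q)))
      where
      p = position i
      q = position j

-- Graphs of constant excess

-- the number of walks v – u – w with w ≠ v
excess : ∀ {n} → Adj n → Fin n → ℕ
excess {n} G v = sumℕ n (λ u → if G v u then degree G u ∸ 1 else 0)

-- Σ_{u ∼ v} d u = d v + b says that every excess is b
module ConstantExcess
  {n} {G : Adj n} (symmetric : ∀ x y → G x y ≡ G y x) (loopless : ∀ x → G x x ≡ false)
  (b : ℕ) (b≢0 : b ≢ 0) (condition : ∀ v → neighbourDegreeSum G v ≡ degree G v + b)
  where

  private
    d = degree G

    term : ∀ v u → ℕ
    term v u = if G v u then d u ∸ 1 else 0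

    term-adjacent : ∀ {v u} → G v u ≡ true → term v u ≡ d u ∸ 1
    term-adjacent {v} {u} vu = cong (λ e → if e then d u ∸ 1 else 0) vu

    suc[m∸1]≡m : ∀ {m} → m ≢ 0 → suc (m ∸ 1) ≡ m
    suc[m∸1]≡m {zero}  0≢0 = ⊥-elim (0≢0 refl)
    suc[m∸1]≡m {suc m} _   = refl

  degree≢0 : ∀ v → d v ≢ 0
  degree≢0 v dv≡0 = b≢0 (begin
    b                          ≡⟨ sym (cong (_+ b) dv≡0) ⟩
    d v + b                    ≡⟨ sym (condition v) ⟩
    neighbourDegreeSum G v     ≡⟨ sumℕ-cong n (λ u → cong (λ e → if e then d u else 0) (count≡0 (G v) dv≡0 u)) ⟩
    sumℕ n (λ _ → 0)           ≡⟨ sumℕ-zero n ⟩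
    0                          ∎)
    where open ≡-Reasoning

  excess≡b : ∀ v → excess G v ≡ b
  excess≡b v = ℕ.+-cancelˡ-≡ (d v) _ _ (begin
    d v + excess G v                                  ≡⟨ sym (sumℕ-distrib-+ n (λ u → indicator (G v u)) (term v)) ⟩
    sumℕ n (λ u → indicator (G v u) + term v u)      ≡⟨ sumℕ-cong n split ⟩
    neighbourDegreeSum G v                            ≡⟨ condition v ⟩
    d v + b                                           ∎)
    where
    open ≡-Reasoning
    split : ∀ u → indicator (G v u) + term v u ≡ (if G v u then d u else 0)
    split u with G v u
    ... | true  = suc[m∸1]≡m (degree≢0 u)
    ... | false = refl

  others-are-leaves : ∀ {v u} → G v u ≡ true → d u ≡ suc b → ∀ {x} → G v x ≡ true → x ≢ u → d x ≡ 1
  others-are-leaves {v} {u} vu du {x} vx x≢u = trans (sym (suc[m∸1]≡m (degree≢0 x))) (cong suc x-term≡0)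
    where
    bound : b + (d x ∸ 1) ≤ b
    bound = subst₂ (λ s t → s + t ≤ b) (trans (term-adjacent vu) (cong (_∸ 1) du)) (term-adjacent vx)
                   (subst (term v u + term v x ≤_) (excess≡b v) (+-≤-sumℕ n (term v) (x≢u ∘ sym)))
    x-term≡0 : d x ∸ 1 ≡ 0
    x-term≡0 = ℕ.n≤0⇒n≡0 (ℕ.+-cancelˡ-≤ b _ 0 (subst (b + (d x ∸ 1) ≤_) (sym (ℕ.+-identityʳ b)) bound))

  leaf-neighbour-degree : ∀ {ℓ y} → d ℓ ≡ 1 → G ℓ y ≡ true → d y ≡ suc b
  leaf-neighbour-degree {ℓ} {y} dℓ ℓy = trans (sym (suc[m∸1]≡m (degree≢0 y))) (cong suc (begin
    d y ∸ 1          ≡⟨ sym (term-adjacent ℓy) ⟩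
    term ℓ y         ≡⟨ sym (sumℕ-supported n (term ℓ) y elsewhere) ⟩
    excess G ℓ       ≡⟨ excess≡b ℓ ⟩
    b                ∎))
    where
    open ≡-Reasoning
    elsewhere : ∀ x → x ≢ y → term ℓ x ≡ 0
    elsewhere x x≢y with G ℓ x in ℓx
    ... | false = refl
    ... | true  = ⊥-elim (x≢y (count≡1 (G ℓ) dℓ ℓx ℓy))

  heavy-neighbour : ∀ v → ∃ λ u → G v u ≡ true × 2 ≤ d u
  heavy-neighbour v with sumℕ-positive n (term v) (subst (0 <_) (sym (excess≡b v)) (ℕ.n≢0⇒n>0 b≢0))
  ... | u , 0<term with G v u in vu
  ...   | true  = u , vu , subst (2 ≤_) (suc[m∸1]≡m (degree≢0 u)) (s≤s 0<term)
  ...   | false = case 0<term of λ ()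

  leaf-neighbour : ∀ {v} → b < d v → ∃ λ ℓ → G v ℓ ≡ true × d ℓ ≡ 1
  leaf-neighbour {v} b<dv with any? (λ x → (G v x Bool.≟ true) ×-dec (d x ℕ.≟ 1))
  ... | yes found = found
  ... | no none   = ⊥-elim (ℕ.<⇒≱ b<dv (subst (d v ≤_) (excess≡b v) (sumℕ-mono-≤ n indicator≤term)))
    where
    1≤m∸1 : ∀ {m} → m ≢ 0 → m ≢ 1 → 1 ≤ m ∸ 1
    1≤m∸1 {zero}        m≢0 _   = ⊥-elim (m≢0 refl)
    1≤m∸1 {suc zero}    _   m≢1 = ⊥-elim (m≢1 refl)
    1≤m∸1 {suc (suc m)} _   _   = s≤s z≤n
    indicator≤term : ∀ x → indicator (G v x) ≤ term v x
    indicator≤term x with G v x in vx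
    ... | false = z≤n
    ... | true  = 1≤m∸1 (degree≢0 x) (λ dx≡1 → none (x , vx , dx≡1))

  leaf : ∀ {w} → d w ≡ 1 ⊎ b < d w → ∃ λ ℓ → d ℓ ≡ 1
  leaf {w} (inj₁ dw≡1) = w , dw≡1
  leaf     (inj₂ b<dw) with leaf-neighbour b<dw
  ... | ℓ , _ , dℓ = ℓ , dℓ

  partner : ∀ {u} → d u ≡ suc b → ∃ λ v → G u v ≡ true × d v ≡ suc b
  partner {u} du with heavy-neighbour u
  ... | v , uv , 2≤dv = v , uv , leaf-neighbour-degree dt (trans (symmetric t v) vt)
    where
    vu = trans (symmetric v u) uv
    other : ∃ λ t → except (G v) u t ≡ true
    other = count-positive (except (G v) u)
              (ℕ.≤-pred (subst (2 ≤_) (count-except (G v) vu) 2≤dv))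
    t = proj₁ other
    vt = proj₁ (except-true {p = G v} (proj₂ other))
    dt : d t ≡ 1
    dt = others-are-leaves vu du vt (proj₂ (except-true {p = G v} (proj₂ other)))

  -- the neighbour of a leaf and its partner are the two centres of S_{b,b}
  ≅-doubleStar : Connected G → ∀ {ℓ} → d ℓ ≡ 1 → G ≅ doubleStar b b
  ≅-doubleStar connected {ℓ} dℓ =
    subst₂ (λ k₁ k₂ → G ≅ doubleStar k₁ k₂) (pendants uv du) (pendants vu dv)
      (DoubleStarRecognition.≅-doubleStar symmetric loopless connected uv
        (λ x ux x≢v → others-are-leaves uv dv ux x≢v) (λ x vx x≢u → others-are-leaves vu du vx x≢u))
    where
    attachment = count-positive (G ℓ) (subst (0 <_) (sym dℓ) (s≤s z≤n))
    u = proj₁ attachment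
    du : d u ≡ suc b
    du = leaf-neighbour-degree dℓ (proj₂ attachment)
    v = proj₁ (partner du)
    uv = proj₁ (proj₂ (partner du))
    dv = proj₂ (proj₂ (partner du))
    vu = trans (symmetric v u) uv
    pendants : ∀ {x y} → G x y ≡ true → d x ≡ suc b → count (except (G x) y) ≡ b
    pendants {x} xy dx = ℕ.suc-injective (trans (sym (count-except (G x) xy)) dx)

-- The classes 𝒢(1,1) and 𝒢(1,2)

DegreeCondition-≅ : ∀ {a b n m} {G : Adj n} {H : Adj m} → G ≅ H → DegreeCondition a b H → DegreeCondition a b G
DegreeCondition-≅ {a} {b} {G = G} {H} iso condition x =
  trans (cong +_ (neighbourDegreeSum-≅ x)) (trans (condition _) (cong (λ k → a ℤ.* + k ℤ.+ b) (sym (degree-≅ x))))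
  where open Isomorphism {G = G} {H} iso

DegreeCondition-ℕ : ∀ {b n} {G : Adj n} → DegreeCondition (+ 1) (+ b) G → ∀ v → neighbourDegreeSum G v ≡ degree G v + b
DegreeCondition-ℕ {b} {G = G} condition v =
  ℤ.+-injective (trans (condition v) (cong (ℤ._+ + b) (ℤ.*-identityˡ (+ degree G v))))

doubleStar₁₁-condition : DegreeCondition (+ 1) (+ 1) (doubleStar 1 1)
doubleStar₁₁-condition 0F = refl
doubleStar₁₁-condition 1F = refl
doubleStar₁₁-condition 2F = refl
doubleStar₁₁-condition 3F = refl

doubleStar₂₂-condition : DegreeCondition (+ 1) (+ 2) (doubleStar 2 2)
doubleStar₂₂-condition 0F = refl
doubleStar₂₂-condition 1F = refl
doubleStar₂₂-condition 2F = refl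
doubleStar₂₂-condition 3F = refl
doubleStar₂₂-condition 4F = refl
doubleStar₂₂-condition 5F = refl

module _ (F : RealClosedField) where
  open Spectrum F using (twoMainEigenvalues; regular-mainEigenvalue; mainEigenvalue⇒vertex)

  inClass-≅ : ∀ {n m} {G : Adj n} {H : Adj m} a b → b ≢ 0 → IsSimpleGraph G → G ≅ H →
              Connected H → DegreeCondition (+ a) (+ b) H → AverageIsNotRoot a b m (sumℕ m (degree H)) →
              InClass F (+ a) (+ b) G
  inClass-≅ {G = G} {H} a b b≢0 (symmetric , _) iso connectedH conditionH D-not-root =
    connected-≅ connectedH , twoMainEigenvalues a b b≢0 symmetric condition not-root , condition
    where
    open Isomorphism {G = G} {H} iso
    condition = DegreeCondition-≅ {+ a} {+ b} iso conditionH
    not-root = subst₂ (AverageIsNotRoot a b) (sym (↔⇒≡ (proj₁ iso))) (sym degreeSum-≅) D-not-root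

  S₁₁∈𝒢[1,1] : ∀ {n} {G : Adj n} → IsSimpleGraph G → G ≅ doubleStar 1 1 → InClass F (+ 1) (+ 1) G
  S₁₁∈𝒢[1,1] simple iso = inClass-≅ 1 1 (λ ()) simple iso (doubleStar-connected 1 1) doubleStar₁₁-condition (λ ())

  S₂₂∈𝒢[1,2] : ∀ {n} {G : Adj n} → IsSimpleGraph G → G ≅ doubleStar 2 2 → InClass F (+ 1) (+ 2) G
  S₂₂∈𝒢[1,2] simple iso = inClass-≅ 1 2 (λ ()) simple iso (doubleStar-connected 2 2) doubleStar₂₂-condition (λ ())

  𝒢[1,1]⊆S₁₁ : ∀ {n} {G : Adj n} → IsSimpleGraph G → InClass F (+ 1) (+ 1) G → G ≅ doubleStar 1 1
  𝒢[1,1]⊆S₁₁ (symmetric , loopless) (connected , (_ , _ , _ , main , _) , condition) =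
    ≅-doubleStar connected (proj₂ (leaf (inj₂ (proj₂ (proj₂ hub)))))
    where
    open ConstantExcess symmetric loopless 1 (λ ()) (DegreeCondition-ℕ condition)
    hub = heavy-neighbour (mainEigenvalue⇒vertex main)

  -- Cycles satisfy the degree condition of 𝒢(1,2) too; they are excluded because a
  -- regular graph has only one main eigenvalue.
  𝒢[1,2]⊆S₂₂ : ∀ {n} {G : Adj n} → IsSimpleGraph G → InClass F (+ 1) (+ 2) G → G ≅ doubleStar 2 2
  𝒢[1,2]⊆S₂₂ {n} {G} (symmetric , loopless) (connected , (λ₁ , λ₂ , λ₁≢λ₂ , main₁ , main₂ , _) , condition) =
    ≅-doubleStar connected (proj₂ (leaf (one-or-above-two (degree≢0 w) (proj₂ irregular))))
    where
    open ConstantExcess symmetric loopless 2 (λ ()) (DegreeCondition-ℕ condition)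
    not-cycle : ¬ (∀ v → degree G v ≡ 2)
    not-cycle regular = λ₁≢λ₂ (trans (regular-mainEigenvalue symmetric 2 regular main₁)
                                      (sym (regular-mainEigenvalue symmetric 2 regular main₂)))
    irregular = ¬∀⟶∃¬ n (λ v → degree G v ≡ 2) (λ v → degree G v ℕ.≟ 2) not-cycle
    w = proj₁ irregular
    one-or-above-two : ∀ {m} → m ≢ 0 → m ≢ 2 → m ≡ 1 ⊎ 2 < m
    one-or-above-two {0}                 m≢0 _   = ⊥-elim (m≢0 refl)
    one-or-above-two {1}                 _   _   = inj₁ refl
    one-or-above-two {2}                 _   m≢2 = ⊥-elim (m≢2 refl)
    one-or-above-two {suc (suc (suc _))} _   _   = inj₂ (s≤s (s≤s (s≤s z≤n)))

theorem4p4 : (F : RealClosedField) →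
    (∀ (n : ℕ) (G : Adj n) → IsSimpleGraph G →
      (InClass F (+ 1) (+ 1) G ⇔ (G ≅ doubleStar 1 1)))
    × (∀ (n : ℕ) (G : Adj n) → IsSimpleGraph G →
      (InClass F (+ 1) (+ 2) G ⇔ (G ≅ doubleStar 2 2)))
theorem4p4 F =
    (λ n G simple → mk⇔ (𝒢[1,1]⊆S₁₁ F simple) (S₁₁∈𝒢[1,1] F simple))
  , (λ n G simple → mk⇔ (𝒢[1,2]⊆S₂₂ F simple) (S₂₂∈𝒢[1,2] F simple))
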